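{- For every integer $n\ge 0$, $$T_{n+2}=\sum_{k=0}^{n}N_kT_{n-k}+N_n,$$ where $T_j$ are the tribonacci numbers and $N_j$ is Narayana's cows sequence.
   Context: Tribonacci numbers: $T_0=T_1=0$, $T_2=1$, $T_n=T_{n-1}+T_{n-2}+T_{n-3}$ for $n\ge3$. Narayana's cows sequence: $N_0=N_1=N_2=1$, $N_n=N_{n-1}+N_{n-3}$ for $n\ge 3$. -}

module Defs where

open import Data.Nat using (ℕ; zero; suc; _+_; _*_; _∸_)

T : ℕ → ℕ
T 0 = 0
T 1 = 0
T 2 = 1
T (suc (suc (suc n))) = T (suc (suc n)) + T (suc n) + T n

N : ℕ → ℕ
N 0 = 1
N 1 = 1
N 2 = 1
N (suc (suc (suc n))) = N (suc (suc n)) + N n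

sumTo : ℕ → (ℕ → ℕ) → ℕ
sumTo zero f = f 0
sumTo (suc n) f = sumTo n f + f (suc n)

-- The convolution of any sequence a with T obeys the tribonacci recurrence up to an
-- extra a (n + 1), contributed by the term a (n + 1) · T 2 (the terms with T 1 and T 0
-- vanish). For a = N, Narayana's recurrence absorbs that extra term, so
-- n ↦ Σ N k · T (n − k) + N n is a tribonacci-like sequence. It agrees with n ↦ T (n + 2)
-- at n = 0, 1, 2, hence everywhere.
module Submission where

open import Defs
open import Data.Nat using (ℕ; zero; suc; _+_; _*_; _∸_; _≤_; z≤n)
open import Data.Nat.Properties
open import Data.Nat.Solver using (module +-*-Solver)
open import Relation.Binary.PropositionalEquality
open ≡-Reasoning

sumTo-cong : ∀ n {f g : ℕ → ℕ} → (∀ {k} → k ≤ n → f k ≡ g k) → sumTo n f ≡ sumTo n g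
sumTo-cong zero    f≗g = f≗g z≤n
sumTo-cong (suc n) f≗g = cong₂ _+_ (sumTo-cong n (λ k≤n → f≗g (m≤n⇒m≤1+n k≤n))) (f≗g ≤-refl)

sumTo-distrib-+ : ∀ n (f g : ℕ → ℕ) → sumTo n (λ k → f k + g k) ≡ sumTo n f + sumTo n g
sumTo-distrib-+ zero    f g = refl
sumTo-distrib-+ (suc n) f g = begin
  sumTo n (λ k → f k + g k) + (f (suc n) + g (suc n))
    ≡⟨ cong (_+ (f (suc n) + g (suc n))) (sumTo-distrib-+ n f g) ⟩
  (sumTo n f + sumTo n g) + (f (suc n) + g (suc n))
    ≡⟨ solve 4 (λ a b c d → (a :+ b) :+ (c :+ d) := (a :+ c) :+ (b :+ d)) refl
               (sumTo n f) (sumTo n g) (f (suc n)) (g (suc n)) ⟩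
  (sumTo n f + f (suc n)) + (sumTo n g + g (suc n)) ∎
  where open +-*-Solver

IsTribonacciLike : (ℕ → ℕ) → Set
IsTribonacciLike f = ∀ n → f (3 + n) ≡ f (2 + n) + f (1 + n) + f n

tribonacciLike-unique : ∀ {f g} → IsTribonacciLike f → IsTribonacciLike g →
                        f 0 ≡ g 0 → f 1 ≡ g 1 → f 2 ≡ g 2 → ∀ n → f n ≡ g n
tribonacciLike-unique {f} {g} rf rg e₀ e₁ e₂ = go
  where
  go : ∀ n → f n ≡ g n
  go 0 = e₀
  go 1 = e₁
  go 2 = e₂
  go (suc (suc (suc n))) = begin
    f (3 + n)                     ≡⟨ rf n ⟩
    f (2 + n) + f (1 + n) + f n   ≡⟨ cong₂ _+_ (cong₂ _+_ (go (suc (suc n))) (go (suc n))) (go n) ⟩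
    g (2 + n) + g (1 + n) + g n   ≡⟨ sym (rg n) ⟩
    g (3 + n)                     ∎

T-m+n∸n : ∀ m n → T (m + n ∸ n) ≡ T m
T-m+n∸n m n = cong T (m+n∸n≡m m n)

module Convolution (a : ℕ → ℕ) where

  conv : ℕ → ℕ
  conv n = sumTo n (λ k → a k * T (n ∸ k))

  -- The first n + 1 terms of conv (m + n), with the index m + n ∸ k rewritten as m + (n ∸ k)
  -- so that T's defining equation applies to it without any arithmetic.
  head : ℕ → ℕ → ℕ
  head m n = sumTo n (λ k → a k * T (m + (n ∸ k)))

  head-rec : ∀ n → head 3 n ≡ head 2 n + head 1 n + head 0 n
  head-rec n = begin
    head 3 n
      ≡⟨ sumTo-cong n (λ {k} _ → distrib₃ (a k) (T (2 + (n ∸ k))) (T (1 + (n ∸ k))) (T (n ∸ k))) ⟩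
    sumTo n (λ k → (a k * T (2 + (n ∸ k)) + a k * T (1 + (n ∸ k))) + a k * T (n ∸ k))
      ≡⟨ sumTo-distrib-+ n _ _ ⟩
    sumTo n (λ k → a k * T (2 + (n ∸ k)) + a k * T (1 + (n ∸ k))) + head 0 n
      ≡⟨ cong (_+ head 0 n) (sumTo-distrib-+ n _ _) ⟩
    head 2 n + head 1 n + head 0 n ∎
    where
    distrib₃ : ∀ x p q r → x * (p + q + r) ≡ x * p + x * q + x * r
    distrib₃ x p q r = trans (*-distribˡ-+ x (p + q) r) (cong (_+ x * r) (*-distribˡ-+ x p q))

  prefix≡head : ∀ m n → sumTo n (λ k → a k * T (m + n ∸ k)) ≡ head m n
  prefix≡head m n = sumTo-cong n (λ {k} k≤n → cong (λ j → a k * T j) (+-∸-assoc m k≤n))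

  +-vanishing-term : ∀ x {k} j → T j ≡ 0 → x + a k * T j ≡ x
  +-vanishing-term x {k} j Tj≡0 = begin
    x + a k * T j  ≡⟨ cong (λ t → x + a k * t) Tj≡0 ⟩
    x + a k * 0    ≡⟨ cong (x +_) (*-zeroʳ (a k)) ⟩
    x + 0          ≡⟨ +-identityʳ x ⟩
    x              ∎

  conv-1+ : ∀ n → conv (1 + n) ≡ head 1 n
  conv-1+ n = trans (+-vanishing-term _ (n ∸ n) (T-m+n∸n 0 n)) (prefix≡head 1 n)

  conv-2+ : ∀ n → conv (2 + n) ≡ head 2 n
  conv-2+ n = begin
    conv (2 + n)
      ≡⟨ +-vanishing-term _ (n ∸ n) (T-m+n∸n 0 n) ⟩
    sumTo n _ + a (1 + n) * T (1 + n ∸ n)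
      ≡⟨ +-vanishing-term _ (1 + n ∸ n) (T-m+n∸n 1 n) ⟩
    sumTo n (λ k → a k * T (2 + n ∸ k))
      ≡⟨ prefix≡head 2 n ⟩
    head 2 n ∎

  conv-3+ : ∀ n → conv (3 + n) ≡ head 3 n + a (1 + n)
  conv-3+ n = begin
    conv (3 + n)
      ≡⟨ +-vanishing-term _ (n ∸ n) (T-m+n∸n 0 n) ⟩
    sumTo n _ + a (1 + n) * T (2 + n ∸ n) + a (2 + n) * T (1 + n ∸ n)
      ≡⟨ +-vanishing-term _ (1 + n ∸ n) (T-m+n∸n 1 n) ⟩
    sumTo n (λ k → a k * T (3 + n ∸ k)) + a (1 + n) * T (2 + n ∸ n)
      ≡⟨ cong₂ _+_ (prefix≡head 3 n) (cong (a (1 + n) *_) (T-m+n∸n 2 n)) ⟩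
    head 3 n + a (1 + n) * 1
      ≡⟨ cong (head 3 n +_) (*-identityʳ (a (1 + n))) ⟩
    head 3 n + a (1 + n) ∎

  conv-rec : ∀ n → conv (3 + n) ≡ conv (2 + n) + conv (1 + n) + conv n + a (1 + n)
  conv-rec n = begin
    conv (3 + n)                               ≡⟨ conv-3+ n ⟩
    head 3 n + a (1 + n)                       ≡⟨ cong (_+ a (1 + n)) (head-rec n) ⟩
    head 2 n + head 1 n + head 0 n + a (1 + n) ≡⟨ cong (λ s → s + conv n + a (1 + n))
                                                        (sym (cong₂ _+_ (conv-2+ n) (conv-1+ n))) ⟩
    conv (2 + n) + conv (1 + n) + conv n + a (1 + n) ∎

open Convolution N using (conv; conv-rec)

conv-N+N-tribonacciLike : IsTribonacciLike (λ n → conv n + N n)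
conv-N+N-tribonacciLike n = begin
  conv (3 + n) + (N (2 + n) + N n)
    ≡⟨ cong (_+ (N (2 + n) + N n)) (conv-rec n) ⟩
  conv (2 + n) + conv (1 + n) + conv n + N (1 + n) + (N (2 + n) + N n)
    ≡⟨ solve 6 (λ c₂ c₁ c₀ n₂ n₁ n₀ → c₂ :+ c₁ :+ c₀ :+ n₁ :+ (n₂ :+ n₀)
                                    := (c₂ :+ n₂) :+ (c₁ :+ n₁) :+ (c₀ :+ n₀)) refl
             (conv (2 + n)) (conv (1 + n)) (conv n) (N (2 + n)) (N (1 + n)) (N n) ⟩
  (conv (2 + n) + N (2 + n)) + (conv (1 + n) + N (1 + n)) + (conv n + N n) ∎
  where open +-*-Solver

theorem16 : (n : ℕ) → T (n + 2) ≡ sumTo n (λ k → N k * T (n ∸ k)) + N n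
theorem16 n = trans (cong T (+-comm n 2))
  (tribonacciLike-unique {λ n → T (2 + n)} {λ n → conv n + N n}
                         (λ _ → refl) conv-N+N-tribonacciLike refl refl refl n)
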